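{- Let $r\ge 0$ be an integer and let $D_m(r)$ denote the rencontres numbers. Then for every positive integer $n$, $$1 + \sum_{k=1}^n \frac{D_{k+r}(r)}{k!\binom{k+r}{r}} = \frac{D_{n+r+2}(r)}{(n+1)!\binom{n+r+2}{r}}.$$
   Context: For integers $m\ge r\ge 0$, the rencontres number $D_m(r)$ is the number of permutations $\sigma$ of $[m]=\{1,\dots,m\}$ having exactly $r$ fixed points (points $k$ with $\sigma(k)=k$). In particular $D_m(0)=D_m$ is the number of derangements of $[m]$. -}

module Defs where

open import Data.Nat using (ℕ; zero; suc; _!)
open import Data.Fin using (Fin; _≟_)
open import Data.Vec using (Vec; []; _∷_; lookup)
open import Data.List using (List; []; _∷_; [_]; map; concatMap; allFin; filterᵇ; length)
open import Data.Bool.ListAction using (all)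
open import Data.Bool using (Bool; not; _∨_; _∧_)
open import Data.Integer using (+_)
open import Data.Rational using (ℚ; _/_; 0ℚ) renaming (_+_ to _+ℚ_)
open import Relation.Nullary.Decidable using (⌊_⌋)

allFuns : (k m : ℕ) → List (Vec (Fin m) k)
allFuns zero    m = [ [] ]
allFuns (suc k) m = concatMap (λ x → map (x ∷_) (allFuns k m)) (allFin m)

-- A self-map of [m] is a permutation iff it is injective (finite set).
isPermᵇ : {m : ℕ} → Vec (Fin m) m → Bool
isPermᵇ {m} v = all (λ i → all (λ j → not ⌊ lookup v i ≟ lookup v j ⌋ ∨ ⌊ i ≟ j ⌋) (allFin m)) (allFin m)

fixedPoints : {m : ℕ} → Vec (Fin m) m → ℕ
fixedPoints {m} v = length (filterᵇ (λ i → ⌊ lookup v i ≟ i ⌋) (allFin m))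

D : (m r : ℕ) → ℕ
D m r = length (filterᵇ (λ v → isPermᵇ v ∧ Data.Nat._≡ᵇ_ (fixedPoints v) r) (allFuns m m))

-- a / d as a rational; only used with d > 0 (convention a/0 = 0 is never relevant).
frac : ℕ → ℕ → ℚ
frac a zero    = 0ℚ
frac a (suc d) = (+ a) / suc d

sum1 : ℕ → (ℕ → ℚ) → ℚ
sum1 zero    f = 0ℚ
sum1 (suc n) f = sum1 n f +ℚ f (suc n)

-- Counting permutations of [k + r] with exactly r fixed points by the image of the first point
-- forces a more general count: bijections between t + a positions and t + a values in which t
-- of the positions have a value of their own, exactly r of which are taken. Choosing the value
-- of the first position gives the same recursion for this count and for
-- (t C r) · partialDerangements (t ∸ r) a, whence D (k + r) r = ((k + r) C r) · d_k with d_k the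
-- derangement number. The summand of the series is therefore d_k / k!, and the series
-- telescopes because d_(n+3) = (n + 2)(d_(n+2) + d_(n+1)).
module Submission where

open import Defs
open import Data.Nat using (ℕ; _+_; _*_; _≤_; _!)
open import Data.Nat.Combinatorics using (_C_)
open import Data.Rational using (ℚ; 1ℚ) renaming (_+_ to _+ℚ_)
open import Relation.Binary.PropositionalEquality using (_≡_)

import Algebra.Properties.CommutativeMonoid.Sum as CommutativeMonoidSum
open import Data.Bool.Base using (Bool; true; false; not; _∧_; _∨_)
open import Data.Bool.ListAction using (all)
open import Data.Bool.Properties using (∧-assoc; ∧-commutativeMonoid; ∧-zeroʳ; ∧-identityʳ; ∨-zeroʳ; ∨-identityʳ)
open import Data.Empty using (⊥-elim)
open import Data.Fin.Base using (Fin; zero; suc)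
open import Data.Fin.Properties using (_≟_; 0≢1+n; suc-injective)
import Data.Integer.Base as ℤ
import Data.Integer.Properties as ℤ
import Data.Integer.Solver as ℤ-Solver
open import Data.List.Base using (List; []; _∷_; _++_; map; concatMap; allFin; filterᵇ; length; tabulate)
open import Data.List.Properties using (map-++; map-cong; map-∘)
open import Data.Nat.Base using (_≡ᵇ_; zero; suc; pred; _<_; _∸_; s≤s; z≤n; compare; less; equal; greater)
open import Data.Nat.Combinatorics using (nCk+nC[k+1]≡[n+1]C[k+1]; nC1≡n; nCk≡nC[n∸k]; k>n⇒nCk≡0; nCn≡1)
open import Data.Nat.ListAction using () renaming (sum to sumˡ)
open import Data.Nat.ListAction.Properties using (sum-++)
open import Data.Nat.Properties
  using (+-comm; +-assoc; +-identityʳ; +-suc; *-zeroʳ; *-identityʳ; *-identityˡ; *-assoc; *-distribʳ-+; +-cancelˡ-≡;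
         m≤m+n; ≤-trans; n≤1+n; n<1+n; pred[n]≤n; +-mono-≤; *-mono-<; m+n∸m≡n; m+n∸n≡m; n∸n≡0; m+[n∸m]≡n; 1≤n!; +-*-semiring)
open import Data.Nat.Solver using (module +-*-Solver)
open +-*-Solver using (solve; _:+_; _:*_; _:=_; con)
import Data.Rational.Properties as ℚ
open import Data.Rational.Unnormalised.Base using (mkℚᵘ; *≡*)
import Data.Rational.Unnormalised.Properties as ℚᵘ
open import Data.Vec.Base using (Vec; []; _∷_; lookup; toList)
import Data.Vec.Base as Vec
open import Data.Vec.Properties using (lookup∘tabulate; length-toList)
open import Function.Base using (_∘_; id)
open import Algebra.Properties.Semiring.Sum +-*-semiring
  using (sum; sum-syntax; sum-cong-≗; sum-replicate-zero; ∑-distrib-+; *-distribʳ-sum)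
open import Relation.Binary.PropositionalEquality using (_≢_; refl; sym; trans; cong; cong₂; subst; module ≡-Reasoning)
open import Relation.Nullary.Decidable using (⌊_⌋; yes; no)

open ≡-Reasoning

-- Binomial coefficients and generalised rencontres numbers

[1+k]*[1+n]C[1+k]≡[1+n]*nCk : ∀ n k → suc k * (suc n C suc k) ≡ suc n * (n C k)
[1+k]*[1+n]C[1+k]≡[1+n]*nCk zero    zero    = refl
[1+k]*[1+n]C[1+k]≡[1+n]*nCk zero    (suc k) = *-zeroʳ (suc (suc k))
[1+k]*[1+n]C[1+k]≡[1+n]*nCk (suc n) zero    = trans (+-identityʳ _) (trans (nC1≡n (suc (suc n))) (sym (*-identityʳ _)))
[1+k]*[1+n]C[1+k]≡[1+n]*nCk (suc n) (suc k) = begin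
  suc (suc k) * (suc (suc n) C suc (suc k))   ≡⟨ cong (suc (suc k) *_) (sym (pascal (suc n) (suc k))) ⟩
  suc (suc k) * (c₁ + c₂)                     ≡⟨ solve 3 (λ k c₁ c₂ → (con 2 :+ k) :* (c₁ :+ c₂) := ((con 1 :+ k) :* c₁ :+ c₁) :+ (con 2 :+ k) :* c₂) refl k c₁ c₂ ⟩
  (suc k * c₁ + c₁) + suc (suc k) * c₂        ≡⟨ cong₂ (λ x y → (x + c₁) + y) ([1+k]*[1+n]C[1+k]≡[1+n]*nCk n k) ([1+k]*[1+n]C[1+k]≡[1+n]*nCk n (suc k)) ⟩
  (suc n * d₁ + c₁) + suc n * d₂              ≡⟨ cong (λ z → (suc n * d₁ + z) + suc n * d₂) (sym (pascal n k)) ⟩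
  (suc n * d₁ + (d₁ + d₂)) + suc n * d₂       ≡⟨ solve 3 (λ n d₁ d₂ → ((con 1 :+ n) :* d₁ :+ (d₁ :+ d₂)) :+ (con 1 :+ n) :* d₂ := (con 2 :+ n) :* (d₁ :+ d₂)) refl n d₁ d₂ ⟩
  suc (suc n) * (d₁ + d₂)                     ≡⟨ cong (suc (suc n) *_) (pascal n k) ⟩
  suc (suc n) * (suc n C suc k)               ∎
  where
  pascal : ∀ n k → n C k + n C suc k ≡ suc n C suc k
  pascal = nCk+nC[k+1]≡[n+1]C[k+1]
  c₁ c₂ d₁ d₂ : ℕ
  c₁ = suc n C suc k
  c₂ = suc n C suc (suc k)
  d₁ = n C k
  d₂ = n C suc k

[1+u]*[1+r+u]Cr≡[1+r+u]*[r+u]Cr : ∀ r u → suc u * (suc (r + u) C r) ≡ suc (r + u) * ((r + u) C r)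
[1+u]*[1+r+u]Cr≡[1+r+u]*[r+u]Cr r u = begin
  suc u * (suc (r + u) C r)                ≡⟨ cong (suc u *_) (nCk≡nC[n∸k] (≤-trans (m≤m+n r u) (n≤1+n _))) ⟩
  suc u * (suc (r + u) C (suc (r + u) ∸ r)) ≡⟨ cong (λ z → suc u * (suc (r + u) C z)) (trans (cong (_∸ r) (sym (+-suc r u))) (m+n∸m≡n r (suc u))) ⟩
  suc u * (suc (r + u) C suc u)            ≡⟨ [1+k]*[1+n]C[1+k]≡[1+n]*nCk (r + u) u ⟩
  suc (r + u) * ((r + u) C u)              ≡⟨ cong (λ z → suc (r + u) * ((r + u) C z)) (sym (m+n∸m≡n r u)) ⟩
  suc (r + u) * ((r + u) C (r + u ∸ r))    ≡⟨ cong (suc (r + u) *_) (sym (nCk≡nC[n∸k] (m≤m+n r u))) ⟩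
  suc (r + u) * ((r + u) C r)              ∎

-- partialDerangements u a counts the bijections between u + a positions and u + a values
-- in which u of the positions must each avoid a forbidden value of their own (these values
-- being distinct); the recursion chooses the image of one of these u positions.
partialDerangements : ℕ → ℕ → ℕ
partialDerangements zero          a = a !
partialDerangements (suc zero)    a = a * a !
partialDerangements (suc (suc u)) a = suc u * partialDerangements u (suc a) + a * partialDerangements (suc u) a

partialDerangements-sucʳ : ∀ u a → partialDerangements u (suc a) ≡ partialDerangements (suc u) a + partialDerangements u a
partialDerangements-sucʳ zero          a = +-comm (a !) (a * a !)
partialDerangements-sucʳ (suc zero)    a = solve 2 (λ a f → (con 1 :+ a) :* (f :+ a :* f) := (con 1 :* (f :+ a :* f) :+ a :* (a :* f)) :+ a :* f) refl a (a !)
partialDerangements-sucʳ (suc (suc u)) a = begin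
  suc u * partialDerangements u (suc (suc a)) + suc a * partialDerangements (suc u) (suc a)
    ≡⟨ cong₂ (λ x y → suc u * x + suc a * y) (partialDerangements-sucʳ u (suc a)) (partialDerangements-sucʳ (suc u) a) ⟩
  suc u * (partialDerangements (suc u) (suc a) + X) + suc a * (Z + W)
    ≡⟨ cong (λ x → suc u * (x + X) + suc a * (Z + W)) (partialDerangements-sucʳ (suc u) a) ⟩
  suc u * ((Z + W) + X) + suc a * (Z + W)
    ≡⟨ solve 4 (λ u a X W → (con 1 :+ u) :* ((((con 1 :+ u) :* X :+ a :* W) :+ W) :+ X) :+ (con 1 :+ a) :* (((con 1 :+ u) :* X :+ a :* W) :+ W)
       := ((con 2 :+ u) :* (((con 1 :+ u) :* X :+ a :* W) :+ W) :+ a :* ((con 1 :+ u) :* X :+ a :* W)) :+ ((con 1 :+ u) :* X :+ a :* W)) refl u a X W ⟩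
  (suc (suc u) * (Z + W) + a * Z) + Z
    ≡⟨ cong (λ x → (suc (suc u) * x + a * Z) + Z) (sym (partialDerangements-sucʳ (suc u) a)) ⟩
  partialDerangements (suc (suc (suc u))) a + partialDerangements (suc (suc u)) a ∎
  where
  X W Z : ℕ
  X = partialDerangements u (suc a)
  W = partialDerangements (suc u) a
  Z = partialDerangements (suc (suc u)) a

partialDerangements-suc-suc : ∀ u a →
  partialDerangements (suc u) (suc a) ≡ suc u * partialDerangements u (suc a) + suc a * partialDerangements (suc u) a
partialDerangements-suc-suc u a = begin
  partialDerangements (suc u) (suc a)                                   ≡⟨ partialDerangements-sucʳ (suc u) a ⟩
  partialDerangements (suc (suc u)) a + partialDerangements (suc u) a   ≡⟨ +-assoc (suc u * X) (a * Y) Y ⟩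
  suc u * X + (a * Y + Y)                                               ≡⟨ cong (suc u * X +_) (+-comm (a * Y) Y) ⟩
  suc u * X + suc a * Y                                                 ∎
  where
  X Y : ℕ
  X = partialDerangements u (suc a)
  Y = partialDerangements (suc u) a

-- partialRencontres t a r counts the bijections as above in which exactly r of the t
-- distinguished positions take their own value; when t < r the truncated t ∸ r is harmless
-- because t C r = 0.
partialRencontres : ℕ → ℕ → ℕ → ℕ
partialRencontres t a r = (t C r) * partialDerangements (t ∸ r) a

partialRencontres⁻ : ℕ → ℕ → ℕ → ℕ
partialRencontres⁻ t a zero    = 0
partialRencontres⁻ t a (suc r) = partialRencontres t a r

partialRencontres-< : ∀ {t r} a → t < r → partialRencontres t a r ≡ 0
partialRencontres-< {t} {r} a t<r rewrite k>n⇒nCk≡0 t<r = refl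

partialRencontres-diag : ∀ r a → partialRencontres r a r ≡ a !
partialRencontres-diag r a rewrite nCn≡1 r | n∸n≡0 r = +-identityʳ (a !)

partialRencontres-+ : ∀ r u a → partialRencontres (r + u) a r ≡ ((r + u) C r) * partialDerangements u a
partialRencontres-+ r u a rewrite m+n∸m≡n r u = refl

partialRencontres-pred-diag : ∀ r a → r * partialRencontres (pred r) a r ≡ 0
partialRencontres-pred-diag zero    a = refl
partialRencontres-pred-diag (suc r) a rewrite partialRencontres-< a (n<1+n r) = *-zeroʳ (suc r)

binomial-absorb : ∀ r u X b Y →
  (suc (r + u) C r) * (suc u * X + b * Y) ≡ suc (r + u) * (((r + u) C r) * X) + b * ((suc (r + u) C r) * Y)
binomial-absorb r u X b Y = begin
  c * (suc u * X + b * Y)             ≡⟨ solve 5 (λ c u X b Y → c :* (u :* X :+ b :* Y) := (u :* c) :* X :+ b :* (c :* Y)) refl c (suc u) X b Y ⟩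
  (suc u * c) * X + b * (c * Y)       ≡⟨ cong (λ z → z * X + b * (c * Y)) ([1+u]*[1+r+u]Cr≡[1+r+u]*[r+u]Cr r u) ⟩
  (suc (r + u) * c′) * X + b * (c * Y) ≡⟨ cong (_+ b * (c * Y)) (*-assoc (suc (r + u)) c′ X) ⟩
  suc (r + u) * (c′ * X) + b * (c * Y) ∎
  where
  c c′ : ℕ
  c = suc (r + u) C r
  c′ = (r + u) C r

1+[r+u]∸r≡1+u : ∀ r u → suc (r + u) ∸ r ≡ suc u
1+[r+u]∸r≡1+u r u = trans (cong (_∸ r) (sym (+-suc r u))) (m+n∸m≡n r (suc u))

partialRencontres-sucʳ : ∀ t a r →
  partialRencontres t (suc a) r ≡ t * partialRencontres (pred t) (suc a) r + suc a * partialRencontres t a r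
partialRencontres-sucʳ t a r with compare t r
... | less .t k
  rewrite partialRencontres-< (suc a) (s≤s (m≤m+n t k))
        | partialRencontres-< {pred t} (suc a) (s≤s (≤-trans pred[n]≤n (m≤m+n t k)))
        | partialRencontres-< a (s≤s (m≤m+n t k))
        | *-zeroʳ t | *-zeroʳ (suc a) = refl
... | equal .r
  rewrite partialRencontres-pred-diag r (suc a) | partialRencontres-diag r a | partialRencontres-diag r (suc a) = refl
... | greater .r u = begin
  partialRencontres t (suc a) r                       ≡⟨ cong (λ z → c * partialDerangements z (suc a)) (1+[r+u]∸r≡1+u r u) ⟩
  c * partialDerangements (suc u) (suc a)             ≡⟨ cong (c *_) (partialDerangements-suc-suc u a) ⟩
  c * (suc u * partialDerangements u (suc a) + suc a * partialDerangements (suc u) a)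
                                                      ≡⟨ binomial-absorb r u _ (suc a) _ ⟩
  t * (((r + u) C r) * partialDerangements u (suc a)) + suc a * (c * partialDerangements (suc u) a)
                                                      ≡⟨ cong₂ (λ x y → t * x + suc a * (c * y))
                                                           (sym (partialRencontres-+ r u (suc a)))
                                                           (cong (λ z → partialDerangements z a) (sym (1+[r+u]∸r≡1+u r u))) ⟩
  t * partialRencontres (r + u) (suc a) r + suc a * partialRencontres t a r ∎
  where
  c : ℕ
  c = t C r

private
  partialRencontres-sucˡ-suc : ∀ t a r →
    (t C suc r) * partialDerangements (t ∸ r) a ≡ t * partialRencontres (pred t) (suc a) (suc r) + a * partialRencontres t a (suc r)
  partialRencontres-sucˡ-suc t a r with compare t (suc r)
  ... | less .t k
    rewrite k>n⇒nCk≡0 (s≤s (m≤m+n t k))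
          | partialRencontres-< {pred t} (suc a) (s≤s (≤-trans pred[n]≤n (m≤m+n t k)))
          | *-zeroʳ t | *-zeroʳ a = refl
  ... | equal .(suc r) = begin
    (suc r C suc r) * partialDerangements (suc r ∸ r) a  ≡⟨ cong₂ (λ c z → c * partialDerangements z a) (nCn≡1 (suc r)) (m+n∸n≡m 1 r) ⟩
    1 * (a * a !)                                        ≡⟨ *-identityˡ (a * a !) ⟩
    a * a !                                              ≡⟨ cong₂ (λ x y → x + a * y)
                                                              (sym (trans (cong (suc r *_) (partialRencontres-< (suc a) (n<1+n r))) (*-zeroʳ (suc r))))
                                                              (sym (partialRencontres-diag (suc r) a)) ⟩
    suc r * partialRencontres r (suc a) (suc r) + a * partialRencontres (suc r) a (suc r) ∎
  ... | greater .(suc r) u = begin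
    (t C suc r) * partialDerangements (t ∸ r) a             ≡⟨ cong (λ z → c * partialDerangements z a) t∸r ⟩
    c * (suc u * partialDerangements u (suc a) + a * partialDerangements (suc u) a)
                                                            ≡⟨ binomial-absorb (suc r) u _ a _ ⟩
    t * (((suc r + u) C suc r) * partialDerangements u (suc a)) + a * (c * partialDerangements (suc u) a)
                                                            ≡⟨ cong₂ (λ x y → t * x + a * (c * partialDerangements y a))
                                                                 (sym (partialRencontres-+ (suc r) u (suc a)))
                                                                 (sym (1+[r+u]∸r≡1+u r u)) ⟩
    t * partialRencontres (suc r + u) (suc a) (suc r) + a * partialRencontres t a (suc r) ∎
    where
    c : ℕ
    c = t C suc r
    t∸r : t ∸ r ≡ suc (suc u)
    t∸r = trans (cong (λ z → suc z ∸ r) (sym (+-suc r u))) (1+[r+u]∸r≡1+u r (suc u))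

partialRencontres-sucˡ : ∀ t a r →
  partialRencontres (suc t) a r
    ≡ partialRencontres⁻ t a r + t * partialRencontres (pred t) (suc a) r + a * partialRencontres t a r
partialRencontres-sucˡ zero    a zero = solve 2 (λ a f → con 1 :* (a :* f) := con 0 :+ con 0 :+ a :* (con 1 :* f)) refl a (a !)
partialRencontres-sucˡ (suc t) a zero =
  solve 4 (λ t a X Y → con 1 :* ((con 1 :+ t) :* X :+ a :* Y) := con 0 :+ (con 1 :+ t) :* (con 1 :* X) :+ a :* (con 1 :* Y))
    refl t a (partialDerangements t (suc a)) (partialDerangements (suc t) a)
partialRencontres-sucˡ t a (suc r) = begin
  (suc t C suc r) * partialDerangements (t ∸ r) a                   ≡⟨ cong (_* partialDerangements (t ∸ r) a) (sym (nCk+nC[k+1]≡[n+1]C[k+1] t r)) ⟩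
  ((t C r) + (t C suc r)) * partialDerangements (t ∸ r) a           ≡⟨ *-distribʳ-+ (partialDerangements (t ∸ r) a) (t C r) (t C suc r) ⟩
  partialRencontres t a r + (t C suc r) * partialDerangements (t ∸ r) a ≡⟨ cong (partialRencontres t a r +_) (partialRencontres-sucˡ-suc t a r) ⟩
  partialRencontres t a r + (t * partialRencontres (pred t) (suc a) (suc r) + a * partialRencontres t a (suc r))
                                                                    ≡⟨ sym (+-assoc (partialRencontres t a r) _ _) ⟩
  partialRencontres t a r + t * partialRencontres (pred t) (suc a) (suc r) + a * partialRencontres t a (suc r) ∎

⟦_⟧ : Bool → ℕ
⟦ true  ⟧ = 1
⟦ false ⟧ = 0

⟦∧⟧ : ∀ a b → ⟦ a ∧ b ⟧ ≡ ⟦ b ⟧ * ⟦ a ⟧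
⟦∧⟧ true  b = sym (*-identityʳ ⟦ b ⟧)
⟦∧⟧ false b = sym (*-zeroʳ ⟦ b ⟧)

∑-const-1 : ∀ n → ∑[ i < n ] 1 ≡ n
∑-const-1 zero    = refl
∑-const-1 (suc n) = cong suc (∑-const-1 n)

length-filterᵇ : ∀ {A : Set} (p : A → Bool) xs → length (filterᵇ p xs) ≡ sumˡ (map (⟦_⟧ ∘ p) xs)
length-filterᵇ p []       = refl
length-filterᵇ p (x ∷ xs) with p x
... | true  = cong suc (length-filterᵇ p xs)
... | false = length-filterᵇ p xs

sum-map-concatMap : ∀ {A B : Set} (f : B → ℕ) (g : A → List B) xs →
  sumˡ (map f (concatMap g xs)) ≡ sumˡ (map (λ x → sumˡ (map f (g x))) xs)
sum-map-concatMap f g []       = refl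
sum-map-concatMap f g (x ∷ xs) = begin
  sumˡ (map f (g x ++ concatMap g xs))          ≡⟨ cong sumˡ (map-++ f (g x) (concatMap g xs)) ⟩
  sumˡ (map f (g x) ++ map f (concatMap g xs))  ≡⟨ sum-++ (map f (g x)) _ ⟩
  sumˡ (map f (g x)) + sumˡ (map f (concatMap g xs))           ≡⟨ cong (sumˡ (map f (g x)) +_) (sum-map-concatMap f g xs) ⟩
  sumˡ (map f (g x)) + sumˡ (map (λ x → sumˡ (map f (g x))) xs) ∎

sum-map-tabulate : ∀ {A : Set} n (f : A → ℕ) (g : Fin n → A) → sumˡ (map f (tabulate g)) ≡ ∑[ i < n ] f (g i)
sum-map-tabulate zero    f g = refl
sum-map-tabulate (suc n) f g = cong (f (g zero) +_) (sum-map-tabulate n f (g ∘ suc))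

sum-map-1≡length : ∀ {A : Set} (xs : List A) → sumˡ (map (λ _ → 1) xs) ≡ length xs
sum-map-1≡length []       = refl
sum-map-1≡length (_ ∷ xs) = cong suc (sum-map-1≡length xs)

countMaps : (k m : ℕ) → (Vec (Fin m) k → Bool) → ℕ
countMaps k m p = sumˡ (map (⟦_⟧ ∘ p) (allFuns k m))

countMaps-cong : ∀ k m {p q : Vec (Fin m) k → Bool} → (∀ w → p w ≡ q w) → countMaps k m p ≡ countMaps k m q
countMaps-cong k m p≗q = cong sumˡ (map-cong (cong ⟦_⟧ ∘ p≗q) (allFuns k m))

countMaps-false : ∀ k m {p : Vec (Fin m) k → Bool} → (∀ w → p w ≡ false) → countMaps k m p ≡ 0
countMaps-false k m p≗false = trans (countMaps-cong k m p≗false) (sum-zeros (allFuns k m))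
  where
  sum-zeros : ∀ {A : Set} (xs : List A) → sumˡ (map (λ _ → 0) xs) ≡ 0
  sum-zeros []       = refl
  sum-zeros (x ∷ xs) = sum-zeros xs

countMaps-suc : ∀ k m (p : Vec (Fin m) (suc k) → Bool) → countMaps (suc k) m p ≡ ∑[ x < m ] countMaps k m (p ∘ (x ∷_))
countMaps-suc k m p = begin
  countMaps (suc k) m p                                                      ≡⟨ sum-map-concatMap (⟦_⟧ ∘ p) _ (allFin m) ⟩
  sumˡ (map (λ x → sumˡ (map (⟦_⟧ ∘ p) (map (x ∷_) (allFuns k m)))) (allFin m)) ≡⟨ sum-map-tabulate m _ id ⟩
  ∑[ x < m ] sumˡ (map (⟦_⟧ ∘ p) (map (x ∷_) (allFuns k m)))                ≡⟨ sum-cong-≗ (λ x → cong sumˡ (sym (map-∘ {g = ⟦_⟧ ∘ p} {f = x ∷_} (allFuns k m)))) ⟩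
  ∑[ x < m ] countMaps k m (p ∘ (x ∷_))                                       ∎

countMaps-∧ˡ : ∀ k m b (p : Vec (Fin m) k → Bool) → countMaps k m (λ w → b ∧ p w) ≡ ⟦ b ⟧ * countMaps k m p
countMaps-∧ˡ k m true  p = sym (+-identityʳ (countMaps k m p))
countMaps-∧ˡ k m false p = countMaps-false k m (λ _ → refl)

∑-linear₃ : ∀ n (f g h : Fin n → ℕ) X Y Z →
  ∑[ x < n ] (f x * X + g x * Y + h x * Z) ≡ sum f * X + sum g * Y + sum h * Z
∑-linear₃ n f g h X Y Z = begin
  ∑[ x < n ] (f x * X + g x * Y + h x * Z)              ≡⟨ ∑-distrib-+ (λ x → f x * X + g x * Y) (λ x → h x * Z) ⟩
  ∑[ x < n ] (f x * X + g x * Y) + ∑[ x < n ] (h x * Z) ≡⟨ cong (_+ ∑[ x < n ] (h x * Z)) (∑-distrib-+ (λ x → f x * X) (λ x → g x * Y)) ⟩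
  ∑[ x < n ] (f x * X) + ∑[ x < n ] (g x * Y) + ∑[ x < n ] (h x * Z)
    ≡⟨ sym (cong₂ _+_ (cong₂ _+_ (*-distribʳ-sum X f) (*-distribʳ-sum Y g)) (*-distribʳ-sum Z h)) ⟩
  sum f * X + sum g * Y + sum h * Z                     ∎

indicator-split : ∀ u e c (V X Y Z : ℕ) →
  (u ≡ false → e ≡ true → V ≡ X) →
  (u ≡ false → e ≡ false → c ≡ true → V ≡ Y) →
  (u ≡ false → e ≡ false → c ≡ false → V ≡ Z) →
  ⟦ not u ⟧ * V ≡ ⟦ not u ∧ e ⟧ * X + ⟦ not (e ∨ u) ∧ c ⟧ * Y + ⟦ not (e ∨ u) ∧ not c ⟧ * Z
indicator-split true  true  c     V X Y Z _   _    _     = refl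
indicator-split true  false c     V X Y Z _   _    _     = refl
indicator-split false true  c     V X Y Z fix _    _     =
  trans (+-identityʳ V) (trans (fix refl refl) (sym (trans (+-identityʳ _) (trans (+-identityʳ _) (+-identityʳ X)))))
indicator-split false false true  V X Y Z _   kill _     = trans (+-identityʳ V) (trans (kill refl refl refl) (sym (trans (+-identityʳ _) (+-identityʳ Y))))
indicator-split false false false V X Y Z _   _    spare = trans (+-identityʳ V) (trans (spare refl refl refl) (sym (+-identityʳ Z)))

-- Injective maps avoiding given values

module Conjunction = CommutativeMonoidSum ∧-commutativeMonoid

⋀ : ∀ {n} → (Fin n → Bool) → Bool
⋀ = Conjunction.sum

all-tabulate : ∀ {A : Set} n (p : A → Bool) (g : Fin n → A) → all p (tabulate g) ≡ ⋀ (p ∘ g)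
all-tabulate zero    p g = refl
all-tabulate (suc n) p g = cong (p (g zero) ∧_) (all-tabulate n p (g ∘ suc))

≟-sym : ∀ {m} (x y : Fin m) → ⌊ x ≟ y ⌋ ≡ ⌊ y ≟ x ⌋
≟-sym x y with x ≟ y | y ≟ x
... | yes _   | yes _   = refl
... | no  _   | no  _   = refl
... | yes x≡y | no  y≢x = ⊥-elim (y≢x (sym x≡y))
... | no  x≢y | yes y≡x = ⊥-elim (x≢y (sym y≡x))

≟-suc : ∀ {m} (x y : Fin m) → ⌊ suc x ≟ suc y ⌋ ≡ ⌊ x ≟ y ⌋
≟-suc x y with x ≟ y
... | yes _ = refl
... | no  _ = refl

≟-refl : ∀ {m} (x : Fin m) → ⌊ x ≟ x ⌋ ≡ true
≟-refl x with x ≟ x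
... | yes _   = refl
... | no  x≢x = ⊥-elim (x≢x refl)

≟-true : ∀ {m} {x y : Fin m} → ⌊ x ≟ y ⌋ ≡ true → x ≡ y
≟-true {x = x} {y} eq with x ≟ y
... | yes x≡y = x≡y

≟-false : ∀ {m} {x y : Fin m} → x ≢ y → ⌊ x ≟ y ⌋ ≡ false
≟-false {x = x} {y} x≢y with x ≟ y
... | yes x≡y = ⊥-elim (x≢y x≡y)
... | no  _   = refl

injectiveᵇ : ∀ {m k} → Vec (Fin m) k → Bool
injectiveᵇ w = ⋀ (λ i → ⋀ (λ j → not ⌊ lookup w i ≟ lookup w j ⌋ ∨ ⌊ i ≟ j ⌋))

isPermᵇ≡injectiveᵇ : ∀ {m} (v : Vec (Fin m) m) → isPermᵇ v ≡ injectiveᵇ v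
isPermᵇ≡injectiveᵇ {m} v = trans (all-tabulate m _ id)
  (Conjunction.sum-cong-≗ (λ i → all-tabulate m (λ j → not ⌊ lookup v i ≟ lookup v j ⌋ ∨ ⌊ i ≟ j ⌋) id))

injectiveᵇ-∷ : ∀ {m k} (x : Fin m) (w : Vec (Fin m) k) →
  injectiveᵇ (x ∷ w) ≡ ⋀ (λ j → not ⌊ x ≟ lookup w j ⌋) ∧ injectiveᵇ w
injectiveᵇ-∷ {k = k} x w = begin
  ((not ⌊ x ≟ x ⌋ ∨ true) ∧ ⋀ (λ j → not ⌊ x ≟ lookup w j ⌋ ∨ false))
    ∧ ⋀ (λ i → (not ⌊ lookup w i ≟ x ⌋ ∨ false) ∧ ⋀ (λ j → not ⌊ lookup w i ≟ lookup w j ⌋ ∨ ⌊ suc i ≟ suc j ⌋))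
    ≡⟨ cong₂ _∧_ (cong₂ _∧_ (∨-zeroʳ (not ⌊ x ≟ x ⌋)) (Conjunction.sum-cong-≗ (λ j → ∨-identityʳ (xFresh j))))
                 (Conjunction.sum-cong-≗ (λ i → cong₂ _∧_ (trans (∨-identityʳ _) (cong not (≟-sym (lookup w i) x)))
                                                     (Conjunction.sum-cong-≗ (λ j → cong (not ⌊ lookup w i ≟ lookup w j ⌋ ∨_) (≟-suc i j)))))  ⟩
  ⋀ xFresh ∧ ⋀ (λ i → xFresh i ∧ ⋀ (λ j → not ⌊ lookup w i ≟ lookup w j ⌋ ∨ ⌊ i ≟ j ⌋))
    ≡⟨ cong (⋀ xFresh ∧_) (Conjunction.∑-distrib-+ xFresh _) ⟩
  ⋀ xFresh ∧ (⋀ xFresh ∧ injectiveᵇ w)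
    ≡⟨ ∧-idem-assoc (⋀ xFresh) (injectiveᵇ w) ⟩
  ⋀ xFresh ∧ injectiveᵇ w ∎
  where
  xFresh : Fin k → Bool
  xFresh j = not ⌊ x ≟ lookup w j ⌋
  ∧-idem-assoc : ∀ a b → a ∧ (a ∧ b) ≡ a ∧ b
  ∧-idem-assoc true  b = refl
  ∧-idem-assoc false b = refl

_∈ᵇ_ : ∀ {m} → Fin m → List (Fin m) → Bool
x ∈ᵇ []       = false
x ∈ᵇ (y ∷ ys) = ⌊ x ≟ y ⌋ ∨ x ∈ᵇ ys

data Distinct {m} : List (Fin m) → Set where
  []  : Distinct []
  _∷_ : ∀ {x xs} → x ∈ᵇ xs ≡ false → Distinct xs → Distinct (x ∷ xs)

freshᵇ : ∀ {m k} → List (Fin m) → Vec (Fin m) k → Bool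
freshᵇ S []      = true
freshᵇ S (x ∷ w) = not (x ∈ᵇ S) ∧ freshᵇ (x ∷ S) w

not-∨ : ∀ a b → not (a ∨ b) ≡ not a ∧ not b
not-∨ true  b = refl
not-∨ false b = refl

freshᵇ-spec : ∀ {m k} (S : List (Fin m)) (w : Vec (Fin m) k) →
  freshᵇ S w ≡ ⋀ (λ j → not (lookup w j ∈ᵇ S)) ∧ injectiveᵇ w
freshᵇ-spec S []                  = refl
freshᵇ-spec {k = suc k} S (x ∷ w) = begin
  not (x ∈ᵇ S) ∧ freshᵇ (x ∷ S) w                                   ≡⟨ cong (not (x ∈ᵇ S) ∧_) (freshᵇ-spec (x ∷ S) w) ⟩
  not (x ∈ᵇ S) ∧ (⋀ (λ j → not (⌊ lookup w j ≟ x ⌋ ∨ lookup w j ∈ᵇ S)) ∧ injectiveᵇ w)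
    ≡⟨ cong (λ b → not (x ∈ᵇ S) ∧ (b ∧ injectiveᵇ w))
         (trans (Conjunction.sum-cong-≗ (λ j → trans (not-∨ ⌊ lookup w j ≟ x ⌋ (lookup w j ∈ᵇ S)) (cong (λ b → not b ∧ avoidsS j) (≟-sym (lookup w j) x))))
                (Conjunction.∑-distrib-+ xFresh avoidsS)) ⟩
  not (x ∈ᵇ S) ∧ ((⋀ xFresh ∧ ⋀ avoidsS) ∧ injectiveᵇ w)           ≡⟨ ∧-interchange (not (x ∈ᵇ S)) (⋀ xFresh) (⋀ avoidsS) (injectiveᵇ w) ⟩
  (not (x ∈ᵇ S) ∧ ⋀ avoidsS) ∧ (⋀ xFresh ∧ injectiveᵇ w)           ≡⟨ cong ((not (x ∈ᵇ S) ∧ ⋀ avoidsS) ∧_) (sym (injectiveᵇ-∷ x w)) ⟩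
  (not (x ∈ᵇ S) ∧ ⋀ avoidsS) ∧ injectiveᵇ (x ∷ w)                  ∎
  where
  xFresh avoidsS : Fin k → Bool
  xFresh  j = not ⌊ x ≟ lookup w j ⌋
  avoidsS j = not (lookup w j ∈ᵇ S)
  ∧-interchange : ∀ a b c d → a ∧ ((b ∧ c) ∧ d) ≡ (a ∧ c) ∧ (b ∧ d)
  ∧-interchange true true  c d = refl
  ∧-interchange true false c d = sym (∧-zeroʳ c)
  ∧-interchange false b    c d = refl

matches : ∀ {m k} → Vec (Fin m) k → Vec (Fin m) k → ℕ
matches {k = k} ℓ w = ∑[ i < k ] ⟦ ⌊ lookup w i ≟ lookup ℓ i ⌋ ⟧

fixedPoints≡matches : ∀ {m} (v : Vec (Fin m) m) → fixedPoints v ≡ matches (Vec.allFin m) v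
fixedPoints≡matches {m} v = begin
  fixedPoints v                              ≡⟨ length-filterᵇ _ (allFin m) ⟩
  sumˡ (map (⟦_⟧ ∘ isFixed) (tabulate id))   ≡⟨ sum-map-tabulate m (⟦_⟧ ∘ isFixed) id ⟩
  ∑[ i < m ] ⟦ isFixed i ⟧                   ≡⟨ sum-cong-≗ (λ i → cong (λ j → ⟦ ⌊ lookup v i ≟ j ⌋ ⟧) (sym (lookup∘tabulate id i))) ⟩
  matches (Vec.allFin m) v                   ∎
  where
  isFixed : Fin m → Bool
  isFixed i = ⌊ lookup v i ≟ i ⌋

countFresh : ∀ {m k} → List (Fin m) → Vec (Fin m) k → ℕ → ℕ
countFresh {m} {k} S ℓ r = countMaps k m (λ w → freshᵇ S w ∧ (matches ℓ w ≡ᵇ r))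

D≡countFresh : ∀ m r → D m r ≡ countFresh [] (Vec.allFin m) r
D≡countFresh m r = trans (length-filterᵇ _ (allFuns m m)) (countMaps-cong m m λ v →
  cong₂ (λ b n → b ∧ (n ≡ᵇ r))
    (trans (isPermᵇ≡injectiveᵇ v) (sym (trans (freshᵇ-spec [] v) (cong (_∧ injectiveᵇ v) (Conjunction.sum-replicate-zero m)))))
    (fixedPoints≡matches v))

∑-indicator-≟ : ∀ m (y : Fin m) (g : Fin m → ℕ) → ∑[ x < m ] (⟦ ⌊ x ≟ y ⌋ ⟧ * g x) ≡ g y
∑-indicator-≟ (suc m) zero    g = trans (cong₂ _+_ (+-identityʳ (g zero)) (sum-replicate-zero m)) (+-identityʳ (g zero))
∑-indicator-≟ (suc m) (suc y) g = trans (sum-cong-≗ (λ x → cong (λ b → ⟦ b ⟧ * g (suc x)) (≟-suc x y))) (∑-indicator-≟ m y (g ∘ suc))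

∑-indicator-∈ᵇ : ∀ m {T : List (Fin m)} (g : Fin m → ℕ) → Distinct T → ∑[ x < m ] (⟦ x ∈ᵇ T ⟧ * g x) ≡ sumˡ (map g T)
∑-indicator-∈ᵇ m g []                       = sum-replicate-zero m
∑-indicator-∈ᵇ m {y ∷ T} g (y∉T ∷ distinct) = begin
  ∑[ x < m ] (⟦ ⌊ x ≟ y ⌋ ∨ x ∈ᵇ T ⟧ * g x)                       ≡⟨ sum-cong-≗ split ⟩
  ∑[ x < m ] (⟦ ⌊ x ≟ y ⌋ ⟧ * g x + ⟦ x ∈ᵇ T ⟧ * g x)             ≡⟨ ∑-distrib-+ (λ x → ⟦ ⌊ x ≟ y ⌋ ⟧ * g x) (λ x → ⟦ x ∈ᵇ T ⟧ * g x) ⟩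
  ∑[ x < m ] (⟦ ⌊ x ≟ y ⌋ ⟧ * g x) + ∑[ x < m ] (⟦ x ∈ᵇ T ⟧ * g x) ≡⟨ cong₂ _+_ (∑-indicator-≟ m y g) (∑-indicator-∈ᵇ m g distinct) ⟩
  g y + sumˡ (map g T)                                             ∎
  where
  split : ∀ x → ⟦ ⌊ x ≟ y ⌋ ∨ x ∈ᵇ T ⟧ * g x ≡ ⟦ ⌊ x ≟ y ⌋ ⟧ * g x + ⟦ x ∈ᵇ T ⟧ * g x
  split x with x ≟ y
  ... | yes refl rewrite y∉T = sym (+-identityʳ _)
  ... | no  _    = refl

alive : ∀ {m} → List (Fin m) → List (Fin m) → ℕ
alive S ys = sumˡ (map (λ y → ⟦ not (y ∈ᵇ S) ⟧) ys)

alive≤length : ∀ {m} (S ys : List (Fin m)) → alive S ys ≤ length ys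
alive≤length S []       = z≤n
alive≤length S (y ∷ ys) = +-mono-≤ (indicator≤1 (not (y ∈ᵇ S))) (alive≤length S ys)
  where
  indicator≤1 : ∀ b → ⟦ b ⟧ ≤ 1
  indicator≤1 true  = s≤s z≤n
  indicator≤1 false = z≤n

alive-∷ : ∀ {m} (S : List (Fin m)) x {ys} → Distinct ys → alive (x ∷ S) ys + ⟦ x ∈ᵇ ys ∧ not (x ∈ᵇ S) ⟧ ≡ alive S ys
alive-∷ S x []                       = refl
alive-∷ S x {y ∷ ys} (y∉ys ∷ distinct) with x ≟ y
... | yes refl rewrite ≟-refl y = begin
  alive (y ∷ S) ys + ⟦ not (y ∈ᵇ S) ⟧   ≡⟨ cong (_+ ⟦ not (y ∈ᵇ S) ⟧) (trans (sym (+-identityʳ _)) y∉ys′) ⟩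
  alive S ys + ⟦ not (y ∈ᵇ S) ⟧         ≡⟨ +-comm (alive S ys) _ ⟩
  ⟦ not (y ∈ᵇ S) ⟧ + alive S ys         ∎
  where
  y∉ys′ : alive (y ∷ S) ys + ⟦ false ∧ not (y ∈ᵇ S) ⟧ ≡ alive S ys
  y∉ys′ = subst (λ b → alive (y ∷ S) ys + ⟦ b ∧ not (y ∈ᵇ S) ⟧ ≡ alive S ys) y∉ys (alive-∷ S y distinct)
... | no x≢y rewrite ≟-sym y x | ≟-false x≢y =
  trans (+-assoc ⟦ not (y ∈ᵇ S) ⟧ _ _) (cong (⟦ not (y ∈ᵇ S) ⟧ +_) (alive-∷ S x distinct))

distinct-tabulate : ∀ {m} n (f : Fin n → Fin m) → (∀ {i j} → f i ≡ f j → i ≡ j) → Distinct (toList (Vec.tabulate f))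
distinct-tabulate zero    f f-injective = []
distinct-tabulate (suc n) f f-injective =
  ∉-tabulate n (f ∘ suc) (λ i f0≡fsi → 0≢1+n (f-injective f0≡fsi)) ∷ distinct-tabulate n (f ∘ suc) (suc-injective ∘ f-injective)
  where
  ∉-tabulate : ∀ n (g : Fin n → Fin _) → (∀ i → f zero ≢ g i) → f zero ∈ᵇ toList (Vec.tabulate g) ≡ false
  ∉-tabulate zero    g f0∉g = refl
  ∉-tabulate (suc n) g f0∉g rewrite ≟-false (f0∉g zero) = ∉-tabulate n (g ∘ suc) (f0∉g ∘ suc)

alive-allFin : ∀ m → alive [] (toList (Vec.allFin m)) ≡ m
alive-allFin m = trans (sum-map-1≡length (toList (Vec.allFin m))) (length-toList (Vec.allFin m))

-- Counting by the value of the first position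

partialRencontres-step : ∀ b τ α a r → ⟦ b ⟧ + a ≡ suc α →
  ⟦ b ⟧ * partialRencontres⁻ τ α r + τ * partialRencontres (pred τ) (suc α) r + a * partialRencontres τ α r
    ≡ partialRencontres (⟦ b ⟧ + τ) a r
partialRencontres-step true  τ α .α       r refl =
  trans (cong (λ x → x + τ * partialRencontres (pred τ) (suc α) r + α * partialRencontres τ α r) (+-identityʳ _))
        (sym (partialRencontres-sucˡ τ α r))
partialRencontres-step false τ α .(suc α) r refl = sym (partialRencontres-sucʳ τ α r)

-- S lists the values used by the entries chosen so far and ℓ the labels of the k positions still
-- to be filled; alive S ℓ counts the positions whose label is still available, a the others.
CountFormula : ℕ → ℕ → Set
CountFormula m k = ∀ (S : List (Fin m)) (ℓ : Vec (Fin m) k) r a →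
  Distinct S → Distinct (toList ℓ) → length S + k ≡ m → alive S (toList ℓ) + a ≡ k →
  countFresh S ℓ r ≡ partialRencontres (alive S (toList ℓ)) a r

countFormula-zero : ∀ m → CountFormula m 0
countFormula-zero m S [] zero    .0 _ _ _ refl = refl
countFormula-zero m S [] (suc r) .0 _ _ _ refl = refl

module CountStep {m k} (countFormula-k : CountFormula m k)
                 (S : List (Fin m)) (l : Fin m) (ls : Vec (Fin m) k) (r α : ℕ)
                 (distinct-S : Distinct S) (l∉ls : l ∈ᵇ toList ls ≡ false) (distinct-ls : Distinct (toList ls))
                 (len : length S + suc k ≡ m) (τ+α≡k : alive S (toList ls) + α ≡ k) where

  τ : ℕ
  τ = alive S (toList ls)

  branch : Fin m → ℕ
  branch x = countMaps k m (λ w → freshᵇ (x ∷ S) w ∧ ((⟦ ⌊ x ≟ l ⌋ ⟧ + matches ls w) ≡ᵇ r))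

  countFresh-∷ : countFresh S (l ∷ ls) r ≡ ∑[ x < m ] (⟦ not (x ∈ᵇ S) ⟧ * branch x)
  countFresh-∷ = trans (countMaps-suc k m _) (sum-cong-≗ λ x →
    trans (countMaps-cong k m (λ w → ∧-assoc (not (x ∈ᵇ S)) _ _)) (countMaps-∧ˡ k m (not (x ∈ᵇ S)) _))

  length-∷ : ∀ x → length (x ∷ S) + k ≡ m
  length-∷ x = trans (sym (+-suc (length S) k)) len

  alive-∷-fresh : ∀ x → x ∈ᵇ S ≡ false → alive (x ∷ S) (toList ls) + ⟦ x ∈ᵇ toList ls ⟧ ≡ τ
  alive-∷-fresh x x∉S = begin
    A + ⟦ x ∈ᵇ toList ls ⟧                ≡⟨ cong (λ b → A + ⟦ b ⟧) (sym (∧-identityʳ _)) ⟩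
    A + ⟦ x ∈ᵇ toList ls ∧ true ⟧         ≡⟨ cong (λ b → A + ⟦ x ∈ᵇ toList ls ∧ not b ⟧) (sym x∉S) ⟩
    A + ⟦ x ∈ᵇ toList ls ∧ not (x ∈ᵇ S) ⟧ ≡⟨ alive-∷ S x distinct-ls ⟩
    τ                                     ∎
    where
    A : ℕ
    A = alive (x ∷ S) (toList ls)

  alive-l∷S : alive (l ∷ S) (toList ls) ≡ τ
  alive-l∷S = trans (sym (+-identityʳ _)) (subst (λ b → alive (l ∷ S) (toList ls) + ⟦ b ∧ not (l ∈ᵇ S) ⟧ ≡ τ) l∉ls (alive-∷ S l distinct-ls))

  branch-other : ∀ x → x ∈ᵇ S ≡ false → ⌊ x ≟ l ⌋ ≡ false → ∀ a →
    alive (x ∷ S) (toList ls) + a ≡ k → branch x ≡ partialRencontres (alive (x ∷ S) (toList ls)) a r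
  branch-other x x∉S x≢l a sum≡k =
    trans (countMaps-cong k m (λ w → cong (λ b → freshᵇ (x ∷ S) w ∧ ((⟦ b ⟧ + matches ls w) ≡ᵇ r)) x≢l))
          (countFormula-k (x ∷ S) ls r a (x∉S ∷ distinct-S) distinct-ls (length-∷ x) sum≡k)

  branch-fixes : ∀ x → x ∈ᵇ S ≡ false → ⌊ x ≟ l ⌋ ≡ true → branch x ≡ partialRencontres⁻ τ α r
  branch-fixes x x∉S x≟l with ≟-true x≟l
  ... | refl = trans (countMaps-cong k m (λ w → cong (λ b → freshᵇ (l ∷ S) w ∧ ((⟦ b ⟧ + matches ls w) ≡ᵇ r)) (≟-refl l))) (fixed r)
    where
    fixed : ∀ r′ → countMaps k m (λ w → freshᵇ (l ∷ S) w ∧ (suc (matches ls w) ≡ᵇ r′)) ≡ partialRencontres⁻ τ α r′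
    fixed zero     = countMaps-false k m (λ w → ∧-zeroʳ _)
    fixed (suc r′) = trans (countFormula-k (l ∷ S) ls r′ α (x∉S ∷ distinct-S) distinct-ls (length-∷ l) (trans (cong (_+ α) alive-l∷S) τ+α≡k))
                           (cong (λ t → partialRencontres t α r′) alive-l∷S)

  branch-kills : ∀ x → x ∈ᵇ S ≡ false → ⌊ x ≟ l ⌋ ≡ false → x ∈ᵇ toList ls ≡ true → branch x ≡ partialRencontres (pred τ) (suc α) r
  branch-kills x x∉S x≢l x∈ls = trans (branch-other x x∉S x≢l (suc α) (trans (+-suc A α) (trans (cong (_+ α) 1+A≡τ) τ+α≡k)))
                                      (cong (λ t → partialRencontres t (suc α) r) (cong pred 1+A≡τ))
    where
    A : ℕ
    A = alive (x ∷ S) (toList ls)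
    1+A≡τ : suc A ≡ τ
    1+A≡τ = trans (+-comm 1 A) (subst (λ b → A + ⟦ b ⟧ ≡ τ) x∈ls (alive-∷-fresh x x∉S))

  branch-spare : ∀ x → x ∈ᵇ S ≡ false → ⌊ x ≟ l ⌋ ≡ false → x ∈ᵇ toList ls ≡ false → branch x ≡ partialRencontres τ α r
  branch-spare x x∉S x≢l x∉ls = trans (branch-other x x∉S x≢l α (trans (cong (_+ α) A≡τ) τ+α≡k)) (cong (λ t → partialRencontres t α r) A≡τ)
    where
    A : ℕ
    A = alive (x ∷ S) (toList ls)
    A≡τ : A ≡ τ
    A≡τ = trans (sym (+-identityʳ A)) (subst (λ b → A + ⟦ b ⟧ ≡ τ) x∉ls (alive-∷-fresh x x∉S))

  -- The value x of the position labelled l is used, fixes it, is the label of a later position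
  -- (which can then no longer be fixed), or is spare.
  fixes kills spare : Fin m → Bool
  fixes x = not (x ∈ᵇ S) ∧ ⌊ x ≟ l ⌋
  kills x = not (x ∈ᵇ (l ∷ S)) ∧ x ∈ᵇ toList ls
  spare x = not (x ∈ᵇ (l ∷ S)) ∧ not (x ∈ᵇ toList ls)

  #fixes≡ : ∑[ x < m ] ⟦ fixes x ⟧ ≡ ⟦ not (l ∈ᵇ S) ⟧
  #fixes≡ = trans (sum-cong-≗ (λ x → ⟦∧⟧ (not (x ∈ᵇ S)) ⌊ x ≟ l ⌋)) (∑-indicator-≟ m l (λ x → ⟦ not (x ∈ᵇ S) ⟧))

  #kills≡ : ∑[ x < m ] ⟦ kills x ⟧ ≡ τ
  #kills≡ = trans (sum-cong-≗ (λ x → ⟦∧⟧ (not (x ∈ᵇ (l ∷ S))) (x ∈ᵇ toList ls)))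
                  (trans (∑-indicator-∈ᵇ m (λ x → ⟦ not (x ∈ᵇ (l ∷ S)) ⟧) distinct-ls) alive-l∷S)

  #spare : ℕ
  #spare = ∑[ x < m ] ⟦ spare x ⟧

  branch-value : ∀ x → ⟦ not (x ∈ᵇ S) ⟧ * branch x
    ≡ ⟦ fixes x ⟧ * partialRencontres⁻ τ α r + ⟦ kills x ⟧ * partialRencontres (pred τ) (suc α) r + ⟦ spare x ⟧ * partialRencontres τ α r
  branch-value x = indicator-split (x ∈ᵇ S) ⌊ x ≟ l ⌋ (x ∈ᵇ toList ls) (branch x) _ _ _ (branch-fixes x) (branch-kills x) (branch-spare x)

  countFresh-∷-value : countFresh S (l ∷ ls) r
    ≡ ⟦ not (l ∈ᵇ S) ⟧ * partialRencontres⁻ τ α r + τ * partialRencontres (pred τ) (suc α) r + #spare * partialRencontres τ α r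
  countFresh-∷-value = begin
    countFresh S (l ∷ ls) r
      ≡⟨ countFresh-∷ ⟩
    ∑[ x < m ] (⟦ not (x ∈ᵇ S) ⟧ * branch x)
      ≡⟨ sum-cong-≗ branch-value ⟩
    ∑[ x < m ] (⟦ fixes x ⟧ * partialRencontres⁻ τ α r + ⟦ kills x ⟧ * partialRencontres (pred τ) (suc α) r + ⟦ spare x ⟧ * partialRencontres τ α r)
      ≡⟨ ∑-linear₃ m _ _ _ _ _ _ ⟩
    ∑[ x < m ] ⟦ fixes x ⟧ * partialRencontres⁻ τ α r + ∑[ x < m ] ⟦ kills x ⟧ * partialRencontres (pred τ) (suc α) r + #spare * partialRencontres τ α r
      ≡⟨ cong₂ (λ f t → f * partialRencontres⁻ τ α r + t * partialRencontres (pred τ) (suc α) r + #spare * partialRencontres τ α r) #fixes≡ #kills≡ ⟩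
    ⟦ not (l ∈ᵇ S) ⟧ * partialRencontres⁻ τ α r + τ * partialRencontres (pred τ) (suc α) r + #spare * partialRencontres τ α r ∎

  length≡#used : length S ≡ ∑[ x < m ] ⟦ x ∈ᵇ S ⟧
  length≡#used = sym (trans (sum-cong-≗ (λ x → sym (*-identityʳ ⟦ x ∈ᵇ S ⟧)))
                           (trans (∑-indicator-∈ᵇ m (λ _ → 1) distinct-S) (sum-map-1≡length S)))

  classes-partition : ∀ x → ⟦ x ∈ᵇ S ⟧ + (⟦ fixes x ⟧ + (⟦ kills x ⟧ + ⟦ spare x ⟧)) ≡ 1
  classes-partition x = partition (x ∈ᵇ S) ⌊ x ≟ l ⌋ (x ∈ᵇ toList ls)
    where
    partition : ∀ u e c → ⟦ u ⟧ + (⟦ not u ∧ e ⟧ + (⟦ not (e ∨ u) ∧ c ⟧ + ⟦ not (e ∨ u) ∧ not c ⟧)) ≡ 1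
    partition true  true  c     = refl
    partition true  false c     = refl
    partition false true  c     = refl
    partition false false true  = refl
    partition false false false = refl

  #spare≡ : length S + (alive S (toList (l ∷ ls)) + #spare) ≡ m
  #spare≡ = begin
    length S + (⟦ not (l ∈ᵇ S) ⟧ + τ + #spare)                     ≡⟨ cong₂ _+_ length≡#used (+-assoc ⟦ not (l ∈ᵇ S) ⟧ τ #spare) ⟩
    ∑[ x < m ] ⟦ x ∈ᵇ S ⟧ + (⟦ not (l ∈ᵇ S) ⟧ + (τ + #spare))       ≡⟨ cong (∑[ x < m ] ⟦ x ∈ᵇ S ⟧ +_) (sym (cong₂ _+_ #fixes≡ (cong (_+ #spare) #kills≡))) ⟩
    ∑[ x < m ] ⟦ x ∈ᵇ S ⟧ + (∑[ x < m ] ⟦ fixes x ⟧ + (∑[ x < m ] ⟦ kills x ⟧ + #spare))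
      ≡⟨ sym (trans (∑-distrib-+ (λ x → ⟦ x ∈ᵇ S ⟧) _) (cong (∑[ x < m ] ⟦ x ∈ᵇ S ⟧ +_)
              (trans (∑-distrib-+ (λ x → ⟦ fixes x ⟧) _) (cong (∑[ x < m ] ⟦ fixes x ⟧ +_) (∑-distrib-+ (λ x → ⟦ kills x ⟧) (λ x → ⟦ spare x ⟧)))))) ⟩
    ∑[ x < m ] (⟦ x ∈ᵇ S ⟧ + (⟦ fixes x ⟧ + (⟦ kills x ⟧ + ⟦ spare x ⟧))) ≡⟨ sum-cong-≗ classes-partition ⟩
    ∑[ x < m ] 1                                                    ≡⟨ ∑-const-1 m ⟩
    m                                                               ∎

countFormula-suc : ∀ {m k} → CountFormula m k → CountFormula m (suc k)
countFormula-suc {m} {k} countFormula-k S (l ∷ ls) r a distinct-S (l∉ls ∷ distinct-ls) len b+τ+a≡1+k = begin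
  countFresh S (l ∷ ls) r
    ≡⟨ countFresh-∷-value ⟩
  ⟦ b ⟧ * partialRencontres⁻ τ α r + τ * partialRencontres (pred τ) (suc α) r + #spare * partialRencontres τ α r
    ≡⟨ cong (λ n → ⟦ b ⟧ * partialRencontres⁻ τ α r + τ * partialRencontres (pred τ) (suc α) r + n * partialRencontres τ α r) #spare≡a ⟩
  ⟦ b ⟧ * partialRencontres⁻ τ α r + τ * partialRencontres (pred τ) (suc α) r + a * partialRencontres τ α r
    ≡⟨ partialRencontres-step b τ α a r b+a≡1+α ⟩
  partialRencontres (⟦ b ⟧ + τ) a r ∎
  where
  b : Bool
  b = not (l ∈ᵇ S)
  τ α : ℕ
  τ = alive S (toList ls)
  α = k ∸ τ
  τ+α≡k : τ + α ≡ k
  τ+α≡k = m+[n∸m]≡n (subst (τ ≤_) (length-toList ls) (alive≤length S (toList ls)))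
  open CountStep countFormula-k S l ls r α distinct-S l∉ls distinct-ls len τ+α≡k hiding (τ)
  #spare≡a : #spare ≡ a
  #spare≡a = +-cancelˡ-≡ (⟦ b ⟧ + τ) _ _ (+-cancelˡ-≡ (length S) _ _ (trans #spare≡ (sym (trans (cong (length S +_) b+τ+a≡1+k) len))))
  b+a≡1+α : ⟦ b ⟧ + a ≡ suc α
  b+a≡1+α = +-cancelˡ-≡ τ _ _ (begin
    τ + (⟦ b ⟧ + a) ≡⟨ sym (+-assoc τ ⟦ b ⟧ a) ⟩
    τ + ⟦ b ⟧ + a   ≡⟨ cong (_+ a) (+-comm τ ⟦ b ⟧) ⟩
    ⟦ b ⟧ + τ + a   ≡⟨ b+τ+a≡1+k ⟩
    suc k           ≡⟨ cong suc (sym τ+α≡k) ⟩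
    suc (τ + α)     ≡⟨ sym (+-suc τ α) ⟩
    τ + suc α       ∎)

countFormula : ∀ m k → CountFormula m k
countFormula m zero    = countFormula-zero m
countFormula m (suc k) = countFormula-suc (countFormula m k)

D≡partialRencontres : ∀ m r → D m r ≡ partialRencontres m 0 r
D≡partialRencontres m r = begin
  D m r                                                          ≡⟨ D≡countFresh m r ⟩
  countFresh [] (Vec.allFin m) r                                 ≡⟨ countFormula m m [] (Vec.allFin m) r 0 [] (distinct-tabulate m id id) refl
                                                                      (trans (+-identityʳ _) (alive-allFin m)) ⟩
  partialRencontres (alive [] (toList (Vec.allFin m))) 0 r       ≡⟨ cong (λ t → partialRencontres t 0 r) (alive-allFin m) ⟩
  partialRencontres m 0 r                                        ∎

-- The series

0<[k+r]Cr : ∀ k r → 0 < (k + r) C r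
0<[k+r]Cr k zero    = s≤s z≤n
0<[k+r]Cr k (suc r) = subst (λ n → 0 < n C suc r) (sym (+-suc k r))
  (subst (0 <_) (nCk+nC[k+1]≡[n+1]C[k+1] (k + r) r) (≤-trans (0<[k+r]Cr k r) (m≤m+n _ _)))

D[k+r]r≡[k+r]Cr*partialDerangements : ∀ k r → D (k + r) r ≡ ((k + r) C r) * partialDerangements k 0
D[k+r]r≡[k+r]Cr*partialDerangements k r =
  trans (D≡partialRencontres (k + r) r) (cong (λ u → ((k + r) C r) * partialDerangements u 0) (m+n∸n≡m k r))

derangements-suc-suc : ∀ n →
  partialDerangements (suc (suc (suc n))) 0 ≡ suc (suc n) * (partialDerangements (suc (suc n)) 0 + partialDerangements (suc n) 0)
derangements-suc-suc n = trans (+-identityʳ _) (cong (suc (suc n) *_) (partialDerangements-sucʳ (suc n) 0))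

frac-cong : ∀ {a b d e} → 0 < d → 0 < e → a * e ≡ b * d → frac a d ≡ frac b e
frac-cong {a} {b} {suc d} {suc e} _ _ ae≡bd = ℚ.fromℚᵘ-cong {mkℚᵘ (ℤ.+ a) d} {mkℚᵘ (ℤ.+ b) e}
  (*≡* (trans (sym (ℤ.pos-* a (suc e))) (trans (cong ℤ.+_ ae≡bd) (ℤ.pos-* b (suc d)))))

frac-+ : ∀ a b {d} → 0 < d → frac a d +ℚ frac b d ≡ frac (a + b) d
frac-+ a b {suc d} _ = ℚ.toℚᵘ-injective
  (ℚᵘ.≃-trans (ℚ.toℚᵘ-homo-+ (frac a (suc d)) (frac b (suc d)))
  (ℚᵘ.≃-trans (ℚᵘ.+-cong (ℚ.toℚᵘ-fromℚᵘ (mkℚᵘ (ℤ.+ a) d)) (ℚ.toℚᵘ-fromℚᵘ (mkℚᵘ (ℤ.+ b) d)))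
  (ℚᵘ.≃-trans (*≡* same-denominator) (ℚᵘ.≃-sym (ℚ.toℚᵘ-fromℚᵘ (mkℚᵘ (ℤ.+ (a + b)) d))))))
  where
  open ℤ-Solver.+-*-Solver using () renaming (solve to ℤ-solve; _:+_ to _⊕_; _:*_ to _⊗_; _:=_ to _⩦_)
  same-denominator : let s = ℤ.+ suc d in (ℤ.+ a ℤ.* s ℤ.+ ℤ.+ b ℤ.* s) ℤ.* s ≡ ℤ.+ (a + b) ℤ.* (s ℤ.* s)
  same-denominator = trans (ℤ-solve 3 (λ a b s → (a ⊗ s ⊕ b ⊗ s) ⊗ s ⩦ (a ⊕ b) ⊗ (s ⊗ s)) refl (ℤ.+ a) (ℤ.+ b) (ℤ.+ suc d))
                           (cong₂ ℤ._*_ (sym (ℤ.pos-+ a b)) refl)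

rencontres-summand : ∀ k j r → frac (D (k + r) r) (j ! * ((k + r) C r)) ≡ frac (partialDerangements k 0) (j !)
rencontres-summand k j r rewrite D[k+r]r≡[k+r]Cr*partialDerangements k r =
  frac-cong (*-mono-< (1≤n! j) (0<[k+r]Cr k r)) (1≤n! j)
    (solve 3 (λ c d f → (c :* d) :* f := d :* (f :* c)) refl ((k + r) C r) (partialDerangements k 0) (j !))

sum1-cong : ∀ n {f g : ℕ → ℚ} → (∀ k → f k ≡ g k) → sum1 n f ≡ sum1 n g
sum1-cong zero    f≗g = refl
sum1-cong (suc n) f≗g = cong₂ _+ℚ_ (sum1-cong n f≗g) (f≗g (suc n))

derangement-series : ∀ n →
  1ℚ +ℚ sum1 n (λ k → frac (partialDerangements k 0) (k !)) ≡ frac (partialDerangements (suc (suc n)) 0) (suc n !)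
derangement-series zero    = refl
derangement-series (suc n) = begin
  1ℚ +ℚ (sum1 n term +ℚ term (suc n))           ≡⟨ sym (ℚ.+-assoc 1ℚ (sum1 n term) (term (suc n))) ⟩
  (1ℚ +ℚ sum1 n term) +ℚ term (suc n)           ≡⟨ cong (_+ℚ term (suc n)) (derangement-series n) ⟩
  frac d₂ (suc n !) +ℚ frac d₁ (suc n !)        ≡⟨ frac-+ d₂ d₁ (1≤n! (suc n)) ⟩
  frac (d₂ + d₁) (suc n !)                      ≡⟨ frac-cong (1≤n! (suc n)) (1≤n! (suc (suc n))) cross ⟩
  frac d₃ (suc (suc n) !)                       ∎
  where
  term : ℕ → ℚ
  term k = frac (partialDerangements k 0) (k !)
  d₁ d₂ d₃ : ℕ
  d₁ = partialDerangements (suc n) 0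
  d₂ = partialDerangements (suc (suc n)) 0
  d₃ = partialDerangements (suc (suc (suc n))) 0
  cross : (d₂ + d₁) * (suc (suc n) * suc n !) ≡ d₃ * suc n !
  cross = trans (solve 3 (λ d m f → d :* (m :* f) := (m :* d) :* f) refl (d₂ + d₁) (suc (suc n)) (suc n !))
                (cong (_* suc n !) (sym (derangements-suc-suc n)))

mainTheorem3 : (r n : ℕ) → 1 ≤ n →
    1ℚ +ℚ sum1 n (λ k → frac (D (k + r) r) ((k !) * ((k + r) C r)))
      ≡ frac (D (n + r + 2) r) (((n + 1) !) * ((n + r + 2) C r))
mainTheorem3 r n _ = begin
  1ℚ +ℚ sum1 n (λ k → frac (D (k + r) r) ((k !) * ((k + r) C r)))
    ≡⟨ cong (1ℚ +ℚ_) (sum1-cong n (λ k → rencontres-summand k k r)) ⟩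
  1ℚ +ℚ sum1 n (λ k → frac (partialDerangements k 0) (k !))
    ≡⟨ derangement-series n ⟩
  frac (partialDerangements (2 + n) 0) ((1 + n) !)
    ≡⟨ sym (rencontres-summand (2 + n) (1 + n) r) ⟩
  frac (D (2 + n + r) r) (((1 + n) !) * ((2 + n + r) C r))
    ≡⟨ cong₂ (λ t s → frac (D t r) ((s !) * (t C r))) (trans (+-assoc 2 n r) (+-comm 2 (n + r))) (+-comm 1 n) ⟩
  frac (D (n + r + 2) r) (((n + 1) !) * ((n + r + 2) C r)) ∎
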